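{- For every QPL derivation there is a QPL derivation with the same hypotheses and the same conclusion in which every axiom (i.e. the label of every axiom node) is local, that is, belongs to the closure $\overline S$ of the set $S$ consisting of the hypotheses and the conclusion.
   Context: Language: first-order, without equality and without function symbols of positive arity; terms are variables and constants; atomic formulas $\top,\bot,R(t_1,\dots,t_j)$; formulas built by $\land,\lor,\to,\forall x,\exists x$; $A(t)$ is substitution of a substitutable term $t$ for free $x$. QPL is the Hilbert-style calculus with rules (premises / conclusion): axioms $\top$ and $A\to A$; $\land$I: $A,B/A\land B$; $\land$E: $A\land B/A$, $A\land B/B$; $\lor$I: $A/A\lor B$, $B/A\lor B$; $\lor$E: $A\lor A/A$; $\to$I: $B/A\to B$; $\to$E: $A,A\to B/B$; $\bot$E: $\bot/A$; $\forall$I: $A/\forall xA$ with $x$ not free in $A$; $\forall$E: $\forall xA(x)/A(t)$; $\exists$I: $A(t)/\exists xA(x)$; $\exists$E: $\exists xA/A$ with $x$ not free in $A$. A derivation is a finite upward-growing formula-labeled tree whose leaves are axiom nodes or hypothesis nodes and whose nonleaf nodes are labeled by rule instances with premises the parents' labels; hypotheses are hypothesis-node labels, the conclusion is the root label. Parameters of a formula: constants occurring in it and variables free in it; a $P$-formula has all parameters in $P$. Fix an individual constant; $\mathrm{Pars}^*(S)$ is the set $P_0$ of parameters of formulas in $S$, plus the fixed constant if $P_0$ contains no constant. Subformulas: $A$ is one of $A$; components of $B\land C$, $B\lor C$, $B\to C$ subformulas are subformulas; if $\forall xB(x)$ or $\exists xB(x)$ is a subformula, so is $B(t)$ for any substitutable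 term $t$. The closure $\overline S$ is the set of $\mathrm{Pars}^*(S)$-formulas that are subformulas of formulas in $S$. -}

module Defs where

open import Data.Nat using (ℕ; _≡ᵇ_)
open import Data.Bool using (Bool; true; false; _∧_; _∨_; not; if_then_else_)
open import Data.List using (List; []; _∷_; _++_; map)
open import Data.Bool.ListAction using (any)
open import Data.List.Membership.Propositional using (_∈_)
open import Data.Product using (Σ; _×_)
open import Data.Sum using (_⊎_)
open import Relation.Binary.PropositionalEquality using (_≡_)

data Term : Set where
  var : ℕ → Term
  con : ℕ → Term

infixr 6 _∧'_
infixr 5 _∨'_
infixr 4 _⇒_

data Formula : Set where
  ⊤' ⊥' : Formula
  rel   : ℕ → List Term → Formula
  _∧'_ _∨'_ _⇒_ : Formula → Formula → Formula
  all ex : ℕ → Formula → Formula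

varInTerm : ℕ → Term → Bool
varInTerm x (var y) = x ≡ᵇ y
varInTerm x (con _) = false

conInTerm : ℕ → Term → Bool
conInTerm c (var _) = false
conInTerm c (con d) = c ≡ᵇ d

freeIn : ℕ → Formula → Bool
freeIn x ⊤' = false
freeIn x ⊥' = false
freeIn x (rel R ts) = any (varInTerm x) ts
freeIn x (A ∧' B) = freeIn x A ∨ freeIn x B
freeIn x (A ∨' B) = freeIn x A ∨ freeIn x B
freeIn x (A ⇒ B) = freeIn x A ∨ freeIn x B
freeIn x (all y A) = not (x ≡ᵇ y) ∧ freeIn x A
freeIn x (ex y A) = not (x ≡ᵇ y) ∧ freeIn x A

conIn : ℕ → Formula → Bool
conIn c ⊤' = false
conIn c ⊥' = false
conIn c (rel R ts) = any (conInTerm c) ts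
conIn c (A ∧' B) = conIn c A ∨ conIn c B
conIn c (A ∨' B) = conIn c A ∨ conIn c B
conIn c (A ⇒ B) = conIn c A ∨ conIn c B
conIn c (all y A) = conIn c A
conIn c (ex y A) = conIn c A

-- Substitution A(t) of t for the free occurrences of x (no renaming),
-- and substitutability of t for x in A.

substTerm : Term → ℕ → Term → Term
substTerm t x (var y) = if x ≡ᵇ y then t else var y
substTerm t x (con c) = con c

_[_/_] : Formula → Term → ℕ → Formula
⊤' [ t / x ] = ⊤'
⊥' [ t / x ] = ⊥'
rel R ts [ t / x ] = rel R (map (substTerm t x) ts)
(A ∧' B) [ t / x ] = (A [ t / x ]) ∧' (B [ t / x ])
(A ∨' B) [ t / x ] = (A [ t / x ]) ∨' (B [ t / x ])
(A ⇒ B) [ t / x ] = (A [ t / x ]) ⇒ (B [ t / x ])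
all y A [ t / x ] = if y ≡ᵇ x then all y A else all y (A [ t / x ])
ex y A [ t / x ] = if y ≡ᵇ x then ex y A else ex y (A [ t / x ])

substitutable : Term → ℕ → Formula → Bool
substitutable t x ⊤' = true
substitutable t x ⊥' = true
substitutable t x (rel R ts) = true
substitutable t x (A ∧' B) = substitutable t x A ∧ substitutable t x B
substitutable t x (A ∨' B) = substitutable t x A ∧ substitutable t x B
substitutable t x (A ⇒ B) = substitutable t x A ∧ substitutable t x B
substitutable t x (all y A) =
  (y ≡ᵇ x) ∨ (substitutable t x A ∧ (not (freeIn x A) ∨ not (varInTerm y t)))
substitutable t x (ex y A) =
  (y ≡ᵇ x) ∨ (substitutable t x A ∧ (not (freeIn x A) ∨ not (varInTerm y t)))

data Deriv : Formula → Set where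
  ax⊤  : Deriv ⊤'
  axId : (A : Formula) → Deriv (A ⇒ A)
  hyp  : (A : Formula) → Deriv A
  ∧I   : ∀ {A B} → Deriv A → Deriv B → Deriv (A ∧' B)
  ∧E₁  : ∀ {A B} → Deriv (A ∧' B) → Deriv A
  ∧E₂  : ∀ {A B} → Deriv (A ∧' B) → Deriv B
  ∨I₁  : ∀ {A} (B : Formula) → Deriv A → Deriv (A ∨' B)
  ∨I₂  : ∀ {B} (A : Formula) → Deriv B → Deriv (A ∨' B)
  ∨E   : ∀ {A} → Deriv (A ∨' A) → Deriv A
  ⇒I   : ∀ {B} (A : Formula) → Deriv B → Deriv (A ⇒ B)
  ⇒E   : ∀ {A B} → Deriv A → Deriv (A ⇒ B) → Deriv B
  ⊥E   : (A : Formula) → Deriv ⊥' → Deriv A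
  ∀I   : ∀ {A} (x : ℕ) → freeIn x A ≡ false → Deriv A → Deriv (all x A)
  ∀E   : ∀ {x A} (t : Term) → substitutable t x A ≡ true →
         Deriv (all x A) → Deriv (A [ t / x ])
  ∃I   : (x : ℕ) (A : Formula) (t : Term) → substitutable t x A ≡ true →
         Deriv (A [ t / x ]) → Deriv (ex x A)
  ∃E   : ∀ {x A} → freeIn x A ≡ false → Deriv (ex x A) → Deriv A

hyps : ∀ {A} → Deriv A → List Formula
hyps ax⊤ = []
hyps (axId A) = []
hyps (hyp A) = A ∷ []
hyps (∧I d e) = hyps d ++ hyps e
hyps (∧E₁ d) = hyps d
hyps (∧E₂ d) = hyps d
hyps (∨I₁ B d) = hyps d
hyps (∨I₂ A d) = hyps d
hyps (∨E d) = hyps d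
hyps (⇒I A d) = hyps d
hyps (⇒E d e) = hyps d ++ hyps e
hyps (⊥E A d) = hyps d
hyps (∀I x p d) = hyps d
hyps (∀E t p d) = hyps d
hyps (∃I x A t p d) = hyps d
hyps (∃E p d) = hyps d

axioms : ∀ {A} → Deriv A → List Formula
axioms ax⊤ = ⊤' ∷ []
axioms (axId A) = (A ⇒ A) ∷ []
axioms (hyp A) = []
axioms (∧I d e) = axioms d ++ axioms e
axioms (∧E₁ d) = axioms d
axioms (∧E₂ d) = axioms d
axioms (∨I₁ B d) = axioms d
axioms (∨I₂ A d) = axioms d
axioms (∨E d) = axioms d
axioms (⇒I A d) = axioms d
axioms (⇒E d e) = axioms d ++ axioms e
axioms (⊥E A d) = axioms d
axioms (∀I x p d) = axioms d
axioms (∀E t p d) = axioms d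
axioms (∃I x A t p d) = axioms d
axioms (∃E p d) = axioms d

IsParam : Term → Formula → Set
IsParam (var x) A = freeIn x A ≡ true
IsParam (con c) A = conIn c A ≡ true

Pars* : ℕ → List Formula → Term → Set
Pars* c₀ S p =
  (Σ Formula λ A → A ∈ S × IsParam p A)
  ⊎ (p ≡ con c₀ × (∀ A c → A ∈ S → conIn c A ≡ false))

IsPFormula : (Term → Set) → Formula → Set
IsPFormula P A = ∀ p → IsParam p A → P p

data SubF : Formula → Formula → Set where
  self : ∀ {A} → SubF A A
  ∧l   : ∀ {A B C} → SubF (B ∧' C) A → SubF B A
  ∧r   : ∀ {A B C} → SubF (B ∧' C) A → SubF C A
  ∨l   : ∀ {A B C} → SubF (B ∨' C) A → SubF B A
  ∨r   : ∀ {A B C} → SubF (B ∨' C) A → SubF C A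
  ⇒l   : ∀ {A B C} → SubF (B ⇒ C) A → SubF B A
  ⇒r   : ∀ {A B C} → SubF (B ⇒ C) A → SubF C A
  ∀s   : ∀ {A x B} (t : Term) → substitutable t x B ≡ true →
         SubF (all x B) A → SubF (B [ t / x ]) A
  ∃s   : ∀ {A x B} (t : Term) → substitutable t x B ≡ true →
         SubF (ex x B) A → SubF (B [ t / x ]) A

InClosure : ℕ → List Formula → Formula → Set
InClosure c₀ S B =
  (Σ Formula λ A → A ∈ S × SubF B A) × IsPFormula (Pars* c₀ S) B

-- The substitution σ sends every
-- parameter outside Pars*(S) to one fixed constant of Pars*(S); it fixes S, commutes with
-- substitution, and maps each subformula of a member of S into the closure of S.
-- The derivation is then evaluated in a glued model: a value of B is a derivation of σB
-- with local axioms (available when B is a subformula of S), or such a derivation of ⊥,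
-- or a value assembled from values of the components of B. Axioms and introduction rules
-- build assembled values; an elimination either takes the value apart or, on a
-- derivation, extends it. Reading a value back as a derivation introduces axioms only at
-- subformulas of S, so reading back the value of the whole derivation at its conclusion
-- gives a derivation with local axioms; its hypotheses are among the original ones, and
-- the ones it lost are restored by ∧I followed by ∧E₁.

module Submission where

open import Defs
open import Data.Nat using (ℕ; _≡ᵇ_)
open import Data.Nat.Properties using (_≟_; ≡ᵇ⇒≡; ≡⇒≡ᵇ)
open import Data.Bool using (Bool; true; false; _∧_; _∨_; not; if_then_else_)
open import Data.Bool.Properties using (T-≡; ∨-conicalˡ; ∨-conicalʳ; ∧-conicalˡ; ∧-conicalʳ)
open import Data.Bool.ListAction using (any)
open import Data.List using (List; []; _∷_; _++_; map)
open import Data.List.Properties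
  using (map-cong; map-cong-local; map-id; map-id-local; map-∘; ++-identityʳ)
open import Data.List.Membership.Propositional using (_∈_)
open import Data.List.Membership.Propositional.Properties
  using (∈-map⁻; ∈-++⁻; ∈-++⁺ˡ; ∈-++⁺ʳ)
open import Data.List.Relation.Binary.Subset.Propositional using (_⊆_)
open import Data.List.Relation.Unary.Any using (here; there)
open import Data.List.Relation.Unary.All as All using (All; []; _∷_)
open import Data.List.Relation.Unary.All.Properties using (++⁺)
open import Data.Product using (Σ; ∃; _×_; _,_; proj₁; proj₂)
open import Data.Sum using (_⊎_; inj₁; inj₂; [_,_]′; map₂)
open import Data.Unit using (⊤; tt)
open import Data.Empty using (⊥; ⊥-elim)
open import Function using (_∘_; id)
open import Function.Bundles using (_⇔_; mk⇔; Equivalence)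
open import Relation.Nullary using (yes; no)
open import Relation.Binary.PropositionalEquality

≡ᵇ-refl : ∀ n → (n ≡ᵇ n) ≡ true
≡ᵇ-refl n = Equivalence.to T-≡ (≡⇒≡ᵇ n n refl)

≡ᵇ-true⇒≡ : ∀ m n → (m ≡ᵇ n) ≡ true → m ≡ n
≡ᵇ-true⇒≡ m n e = ≡ᵇ⇒≡ m n (Equivalence.from T-≡ e)

≢⇒≡ᵇ-false : ∀ {m n} → m ≢ n → (m ≡ᵇ n) ≡ false
≢⇒≡ᵇ-false {m} {n} m≢n with m ≡ᵇ n in e
... | false = refl
... | true = ⊥-elim (m≢n (≡ᵇ-true⇒≡ m n e))

true-or-false : ∀ b → b ≡ true ⊎ b ≡ false
true-or-false true = inj₁ refl
true-or-false false = inj₂ refl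

true≢false : ∀ {b} → b ≡ true → b ≢ false
true≢false refl ()

∨-introˡ : ∀ {a} b → a ≡ true → a ∨ b ≡ true
∨-introˡ b refl = refl

∨-introʳ : ∀ a {b} → b ≡ true → a ∨ b ≡ true
∨-introʳ true _ = refl
∨-introʳ false e = e

∨-elim : ∀ a {b} → a ∨ b ≡ true → a ≡ true ⊎ b ≡ true
∨-elim true _ = inj₁ refl
∨-elim false e = inj₂ e

not-true⇒false : ∀ {b} → not b ≡ true → b ≡ false
not-true⇒false {false} _ = refl

∧-intro : ∀ {a b} → a ≡ true → b ≡ true → a ∧ b ≡ true
∧-intro refl refl = refl

∨-restrictˡ : ∀ {P : ℕ → Set} {f g : ℕ → Bool} →
              (∀ z → f z ∨ g z ≡ true → P z) → ∀ z → f z ≡ true → P z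
∨-restrictˡ h z e = h z (∨-introˡ _ e)

∨-restrictʳ : ∀ {P : ℕ → Set} {f g : ℕ → Bool} →
              (∀ z → f z ∨ g z ≡ true → P z) → ∀ z → g z ≡ true → P z
∨-restrictʳ {f = f} h z e = h z (∨-introʳ (f z) e)

any-intro : ∀ {X : Set} (p : X → Bool) {x xs} → x ∈ xs → p x ≡ true → any p xs ≡ true
any-intro p {xs = y ∷ _} (here refl) e = ∨-introˡ _ e
any-intro p {xs = y ∷ _} (there x∈xs) e = ∨-introʳ (p y) (any-intro p x∈xs e)

any-witness : ∀ {X : Set} (p : X → Bool) xs → any p xs ≡ true →
              ∃ λ x → x ∈ xs × p x ≡ true
any-witness p (x ∷ xs) e with ∨-elim (p x) e
... | inj₁ px = x , here refl , px
... | inj₂ rest with any-witness p xs rest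
...   | y , y∈xs , py = y , there y∈xs , py

any-false : ∀ {X : Set} (p : X → Bool) {x xs} → any p xs ≡ false → x ∈ xs → p x ≡ false
any-false p {x} none x∈xs with true-or-false (p x)
... | inj₁ px = ⊥-elim (true≢false (any-intro p x∈xs px) none)
... | inj₂ ¬px = ¬px

any-restrict : ∀ {X : Set} {P : ℕ → Set} (f : ℕ → X → Bool) {x xs} →
               (∀ z → any (f z) xs ≡ true → P z) → x ∈ xs → ∀ z → f z x ≡ true → P z
any-restrict f h x∈xs z e = h z (any-intro (f z) x∈xs e)

freeIn-under-≢ : ∀ {z y} B → z ≢ y → not (z ≡ᵇ y) ∧ freeIn z B ≡ freeIn z B
freeIn-under-≢ B z≢y rewrite ≢⇒≡ᵇ-false z≢y = refl

freeIn-under-self : ∀ z B → not (z ≡ᵇ z) ∧ freeIn z B ≡ false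
freeIn-under-self z B rewrite ≡ᵇ-refl z = refl

substTerm-notIn : ∀ t x u → varInTerm x u ≡ false → substTerm t x u ≡ u
substTerm-notIn t x (var y) e rewrite e = refl
substTerm-notIn t x (con c) e = refl

subst-notFree : ∀ t x B → freeIn x B ≡ false → B [ t / x ] ≡ B
subst-notFree t x ⊤' e = refl
subst-notFree t x ⊥' e = refl
subst-notFree t x (rel R ts) e =
  cong (rel R) (map-id-local (All.tabulate λ {u} u∈ts →
    substTerm-notIn t x u (any-false (varInTerm x) e u∈ts)))
subst-notFree t x (A ∧' B) e =
  cong₂ _∧'_ (subst-notFree t x A (∨-conicalˡ _ _ e)) (subst-notFree t x B (∨-conicalʳ _ _ e))
subst-notFree t x (A ∨' B) e =
  cong₂ _∨'_ (subst-notFree t x A (∨-conicalˡ _ _ e)) (subst-notFree t x B (∨-conicalʳ _ _ e))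
subst-notFree t x (A ⇒ B) e =
  cong₂ _⇒_ (subst-notFree t x A (∨-conicalˡ _ _ e)) (subst-notFree t x B (∨-conicalʳ _ _ e))
subst-notFree t x (all y B) e with y ≟ x
... | yes refl rewrite ≡ᵇ-refl y = refl
... | no y≢x rewrite ≢⇒≡ᵇ-false y≢x =
  cong (all y) (subst-notFree t x B (trans (sym (freeIn-under-≢ B (y≢x ∘ sym))) e))
subst-notFree t x (ex y B) e with y ≟ x
... | yes refl rewrite ≡ᵇ-refl y = refl
... | no y≢x rewrite ≢⇒≡ᵇ-false y≢x =
  cong (ex y) (subst-notFree t x B (trans (sym (freeIn-under-≢ B (y≢x ∘ sym))) e))

substTerm-self : ∀ x u → substTerm (var x) x u ≡ u
substTerm-self x (var y) with x ≟ y
... | yes refl rewrite ≡ᵇ-refl x = refl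
... | no x≢y rewrite ≢⇒≡ᵇ-false x≢y = refl
substTerm-self x (con c) = refl

subst-self : ∀ x B → B [ var x / x ] ≡ B
subst-self x ⊤' = refl
subst-self x ⊥' = refl
subst-self x (rel R ts) = cong (rel R) (trans (map-cong (substTerm-self x) ts) (map-id ts))
subst-self x (A ∧' B) = cong₂ _∧'_ (subst-self x A) (subst-self x B)
subst-self x (A ∨' B) = cong₂ _∨'_ (subst-self x A) (subst-self x B)
subst-self x (A ⇒ B) = cong₂ _⇒_ (subst-self x A) (subst-self x B)
subst-self x (all y B) with y ≟ x
... | yes refl rewrite ≡ᵇ-refl y = refl
... | no y≢x rewrite ≢⇒≡ᵇ-false y≢x = cong (all y) (subst-self x B)
subst-self x (ex y B) with y ≟ x
... | yes refl rewrite ≡ᵇ-refl y = refl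
... | no y≢x rewrite ≢⇒≡ᵇ-false y≢x = cong (ex y) (subst-self x B)

substitutable-self : ∀ x B → substitutable (var x) x B ≡ true
substitutable-self x ⊤' = refl
substitutable-self x ⊥' = refl
substitutable-self x (rel R ts) = refl
substitutable-self x (A ∧' B) = ∧-intro (substitutable-self x A) (substitutable-self x B)
substitutable-self x (A ∨' B) = ∧-intro (substitutable-self x A) (substitutable-self x B)
substitutable-self x (A ⇒ B) = ∧-intro (substitutable-self x A) (substitutable-self x B)
substitutable-self x (all y B) with y ≟ x
... | yes refl rewrite ≡ᵇ-refl y = refl
... | no y≢x rewrite ≢⇒≡ᵇ-false y≢x | substitutable-self x B = ∨-introʳ (not (freeIn x B)) refl
substitutable-self x (ex y B) with y ≟ x
... | yes refl rewrite ≡ᵇ-refl y = refl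
... | no y≢x rewrite ≢⇒≡ᵇ-false y≢x | substitutable-self x B = ∨-introʳ (not (freeIn x B)) refl

SubF-all-body : ∀ {x B A} → SubF (all x B) A → SubF B A
SubF-all-body {x} {B} {A} p =
  subst (λ F → SubF F A) (subst-self x B) (∀s (var x) (substitutable-self x B) p)

SubF-ex-body : ∀ {x B A} → SubF (ex x B) A → SubF B A
SubF-ex-body {x} {B} {A} p =
  subst (λ F → SubF F A) (subst-self x B) (∃s (var x) (substitutable-self x B) p)

-- Collapsing parameters

VarSet : Set
VarSet = ℕ → Bool

extend : VarSet → ℕ → VarSet
extend K y z = (z ≡ᵇ y) ∨ K z

extend-self : ∀ K y → extend K y y ≡ true
extend-self K y rewrite ≡ᵇ-refl y = refl

extend-other : ∀ K {y z} → z ≢ y → extend K y z ≡ K z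
extend-other K z≢y rewrite ≢⇒≡ᵇ-false z≢y = refl

extend-idem : ∀ K x z → extend (extend K x) x z ≡ extend K x z
extend-idem K x z with z ≡ᵇ x
... | true = refl
... | false = refl

extend-comm : ∀ K x y z → extend (extend K y) x z ≡ extend (extend K x) y z
extend-comm K x y z with z ≡ᵇ x | z ≡ᵇ y
... | true | true = refl
... | true | false = refl
... | false | true = refl
... | false | false = refl

module Collapse (keptCon : ℕ → Bool) (k : ℕ) where

  collapseTerm : VarSet → Term → Term
  collapseTerm K (var z) = if K z then var z else con k
  collapseTerm K (con c) = if keptCon c then con c else con k

  collapse : VarSet → Formula → Formula
  collapse K ⊤' = ⊤'
  collapse K ⊥' = ⊥'
  collapse K (rel R ts) = rel R (map (collapseTerm K) ts)
  collapse K (A ∧' B) = collapse K A ∧' collapse K B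
  collapse K (A ∨' B) = collapse K A ∨' collapse K B
  collapse K (A ⇒ B) = collapse K A ⇒ collapse K B
  collapse K (all y A) = all y (collapse (extend K y) A)
  collapse K (ex y A) = ex y (collapse (extend K y) A)

  collapseTerm-cong : ∀ K K' t → (∀ z → varInTerm z t ≡ true → K z ≡ K' z) →
                      collapseTerm K t ≡ collapseTerm K' t
  collapseTerm-cong K K' (var z) h rewrite h z (≡ᵇ-refl z) = refl
  collapseTerm-cong K K' (con c) h = refl

  extend-cong : ∀ K K' y B → (∀ z → not (z ≡ᵇ y) ∧ freeIn z B ≡ true → K z ≡ K' z) →
                ∀ z → freeIn z B ≡ true → extend K y z ≡ extend K' y z
  extend-cong K K' y B h z fz with z ≟ y
  ... | yes refl rewrite extend-self K z | extend-self K' z = refl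
  ... | no z≢y rewrite extend-other K z≢y | extend-other K' z≢y =
    h z (trans (freeIn-under-≢ B z≢y) fz)

  collapse-cong : ∀ K K' B → (∀ z → freeIn z B ≡ true → K z ≡ K' z) →
                  collapse K B ≡ collapse K' B
  collapse-cong K K' ⊤' h = refl
  collapse-cong K K' ⊥' h = refl
  collapse-cong K K' (rel R ts) h =
    cong (rel R) (map-cong-local (All.tabulate λ {t} t∈ts →
      collapseTerm-cong K K' t (any-restrict varInTerm h t∈ts)))
  collapse-cong K K' (A ∧' B) h =
    cong₂ _∧'_ (collapse-cong K K' A (∨-restrictˡ h)) (collapse-cong K K' B (∨-restrictʳ h))
  collapse-cong K K' (A ∨' B) h =
    cong₂ _∨'_ (collapse-cong K K' A (∨-restrictˡ h)) (collapse-cong K K' B (∨-restrictʳ h))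
  collapse-cong K K' (A ⇒ B) h =
    cong₂ _⇒_ (collapse-cong K K' A (∨-restrictˡ h)) (collapse-cong K K' B (∨-restrictʳ h))
  collapse-cong K K' (all y B) h = cong (all y) (collapse-cong _ _ B (extend-cong K K' y B h))
  collapse-cong K K' (ex y B) h = cong (ex y) (collapse-cong _ _ B (extend-cong K K' y B h))

  varInTerm-collapse : ∀ K t z → varInTerm z (collapseTerm K t) ≡ true →
                       varInTerm z t ≡ true × K z ≡ true
  varInTerm-collapse K (var w) z e with K w in Kw
  ... | true with ≡ᵇ-true⇒≡ z w e
  ...   | refl = e , Kw
  varInTerm-collapse K (con c) z e with keptCon c
  varInTerm-collapse K (con c) z () | true
  varInTerm-collapse K (con c) z () | false

  freeIn-collapse : ∀ K B z → freeIn z (collapse K B) ≡ true →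
                    freeIn z B ≡ true × K z ≡ true
  freeIn-collapse-∨ : ∀ K A B z → freeIn z (collapse K A) ∨ freeIn z (collapse K B) ≡ true →
                      freeIn z A ∨ freeIn z B ≡ true × K z ≡ true
  freeIn-collapse-under : ∀ K y B z → not (z ≡ᵇ y) ∧ freeIn z (collapse (extend K y) B) ≡ true →
                          not (z ≡ᵇ y) ∧ freeIn z B ≡ true × K z ≡ true

  freeIn-collapse K ⊤' z ()
  freeIn-collapse K ⊥' z ()
  freeIn-collapse K (rel R ts) z e with any-witness (varInTerm z) (map (collapseTerm K) ts) e
  ... | u , u∈ts , zu with ∈-map⁻ (collapseTerm K) u∈ts
  ...   | t , t∈ts , refl with varInTerm-collapse K t z zu
  ...     | zt , Kz = any-intro (varInTerm z) t∈ts zt , Kz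
  freeIn-collapse K (A ∧' B) z e = freeIn-collapse-∨ K A B z e
  freeIn-collapse K (A ∨' B) z e = freeIn-collapse-∨ K A B z e
  freeIn-collapse K (A ⇒ B) z e = freeIn-collapse-∨ K A B z e
  freeIn-collapse K (all y B) z e = freeIn-collapse-under K y B z e
  freeIn-collapse K (ex y B) z e = freeIn-collapse-under K y B z e

  freeIn-collapse-∨ K A B z e with ∨-elim (freeIn z (collapse K A)) e
  ... | inj₁ zA = let zA' , Kz = freeIn-collapse K A z zA in ∨-introˡ _ zA' , Kz
  ... | inj₂ zB = let zB' , Kz = freeIn-collapse K B z zB in ∨-introʳ (freeIn z A) zB' , Kz

  freeIn-collapse-under K y B z e with z ≟ y
  ... | yes refl rewrite freeIn-under-self z (collapse (extend K z) B) =
    ⊥-elim (true≢false e refl)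
  ... | no z≢y rewrite freeIn-under-≢ (collapse (extend K y) B) z≢y | freeIn-under-≢ B z≢y =
    let zB , Kz = freeIn-collapse (extend K y) B z e in zB , trans (sym (extend-other K z≢y)) Kz

  notFree-collapse : ∀ K B x → freeIn x B ≡ false → freeIn x (collapse K B) ≡ false
  notFree-collapse K B x e with true-or-false (freeIn x (collapse K B))
  ... | inj₁ free = ⊥-elim (true≢false (proj₁ (freeIn-collapse K B x free)) e)
  ... | inj₂ notFree = notFree

  conInTerm-collapse : ∀ K t c → conInTerm c (collapseTerm K t) ≡ true →
                       keptCon c ≡ true ⊎ c ≡ k
  conInTerm-collapse K (var w) c e with K w
  conInTerm-collapse K (var w) c () | true
  ... | false = inj₂ (≡ᵇ-true⇒≡ c k e)
  conInTerm-collapse K (con d) c e with keptCon d in kept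
  ... | true with ≡ᵇ-true⇒≡ c d e
  ...   | refl = inj₁ kept
  conInTerm-collapse K (con d) c e | false = inj₂ (≡ᵇ-true⇒≡ c k e)

  conIn-collapse : ∀ K B c → conIn c (collapse K B) ≡ true → keptCon c ≡ true ⊎ c ≡ k
  conIn-collapse-∨ : ∀ K A B c → conIn c (collapse K A) ∨ conIn c (collapse K B) ≡ true →
                     keptCon c ≡ true ⊎ c ≡ k

  conIn-collapse K ⊤' c ()
  conIn-collapse K ⊥' c ()
  conIn-collapse K (rel R ts) c e with any-witness (conInTerm c) (map (collapseTerm K) ts) e
  ... | u , u∈ts , cu with ∈-map⁻ (collapseTerm K) u∈ts
  ...   | t , _ , refl = conInTerm-collapse K t c cu
  conIn-collapse K (A ∧' B) c e = conIn-collapse-∨ K A B c e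
  conIn-collapse K (A ∨' B) c e = conIn-collapse-∨ K A B c e
  conIn-collapse K (A ⇒ B) c e = conIn-collapse-∨ K A B c e
  conIn-collapse K (all y B) c e = conIn-collapse (extend K y) B c e
  conIn-collapse K (ex y B) c e = conIn-collapse (extend K y) B c e

  conIn-collapse-∨ K A B c e with ∨-elim (conIn c (collapse K A)) e
  ... | inj₁ cA = conIn-collapse K A c cA
  ... | inj₂ cB = conIn-collapse K B c cB

  collapseTerm-id : ∀ K t → (∀ z → varInTerm z t ≡ true → K z ≡ true) →
                    (∀ c → conInTerm c t ≡ true → keptCon c ≡ true) → collapseTerm K t ≡ t
  collapseTerm-id K (var z) hv hc rewrite hv z (≡ᵇ-refl z) = refl
  collapseTerm-id K (con c) hv hc rewrite hc c (≡ᵇ-refl c) = refl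

  extend-true : ∀ K y B → (∀ z → not (z ≡ᵇ y) ∧ freeIn z B ≡ true → K z ≡ true) →
                ∀ z → freeIn z B ≡ true → extend K y z ≡ true
  extend-true K y B h z fz with z ≟ y
  ... | yes refl = extend-self K z
  ... | no z≢y rewrite extend-other K z≢y = h z (trans (freeIn-under-≢ B z≢y) fz)

  collapse-id : ∀ K B → (∀ z → freeIn z B ≡ true → K z ≡ true) →
                (∀ c → conIn c B ≡ true → keptCon c ≡ true) → collapse K B ≡ B
  collapse-id K ⊤' hv hc = refl
  collapse-id K ⊥' hv hc = refl
  collapse-id K (rel R ts) hv hc =
    cong (rel R) (map-id-local (All.tabulate λ {t} t∈ts →
      collapseTerm-id K t (any-restrict varInTerm hv t∈ts) (any-restrict conInTerm hc t∈ts)))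
  collapse-id K (A ∧' B) hv hc =
    cong₂ _∧'_ (collapse-id K A (∨-restrictˡ hv) (∨-restrictˡ hc))
             (collapse-id K B (∨-restrictʳ hv) (∨-restrictʳ hc))
  collapse-id K (A ∨' B) hv hc =
    cong₂ _∨'_ (collapse-id K A (∨-restrictˡ hv) (∨-restrictˡ hc))
             (collapse-id K B (∨-restrictʳ hv) (∨-restrictʳ hc))
  collapse-id K (A ⇒ B) hv hc =
    cong₂ _⇒_ (collapse-id K A (∨-restrictˡ hv) (∨-restrictˡ hc))
             (collapse-id K B (∨-restrictʳ hv) (∨-restrictʳ hc))
  collapse-id K (all y B) hv hc = cong (all y) (collapse-id _ B (extend-true K y B hv) hc)
  collapse-id K (ex y B) hv hc = cong (ex y) (collapse-id _ B (extend-true K y B hv) hc)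

  substitutable-collapse : ∀ K B s t x → (∀ y → varInTerm y s ≡ true → varInTerm y t ≡ true) →
                           substitutable t x B ≡ true → substitutable s x (collapse K B) ≡ true
  substitutable-collapse-under :
    ∀ K y B s t x → (∀ y → varInTerm y s ≡ true → varInTerm y t ≡ true) →
    (y ≡ᵇ x) ∨ (substitutable t x B ∧ (not (freeIn x B) ∨ not (varInTerm y t))) ≡ true →
    (y ≡ᵇ x) ∨ (substitutable s x (collapse (extend K y) B)
                 ∧ (not (freeIn x (collapse (extend K y) B)) ∨ not (varInTerm y s))) ≡ true

  substitutable-collapse K ⊤' s t x s⊆t e = refl
  substitutable-collapse K ⊥' s t x s⊆t e = refl
  substitutable-collapse K (rel R ts) s t x s⊆t e = refl
  substitutable-collapse K (A ∧' B) s t x s⊆t e =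
    ∧-intro (substitutable-collapse K A s t x s⊆t (∧-conicalˡ _ _ e))
            (substitutable-collapse K B s t x s⊆t (∧-conicalʳ _ _ e))
  substitutable-collapse K (A ∨' B) s t x s⊆t e =
    ∧-intro (substitutable-collapse K A s t x s⊆t (∧-conicalˡ _ _ e))
            (substitutable-collapse K B s t x s⊆t (∧-conicalʳ _ _ e))
  substitutable-collapse K (A ⇒ B) s t x s⊆t e =
    ∧-intro (substitutable-collapse K A s t x s⊆t (∧-conicalˡ _ _ e))
            (substitutable-collapse K B s t x s⊆t (∧-conicalʳ _ _ e))
  substitutable-collapse K (all y B) s t x s⊆t e = substitutable-collapse-under K y B s t x s⊆t e
  substitutable-collapse K (ex y B) s t x s⊆t e = substitutable-collapse-under K y B s t x s⊆t e

  substitutable-collapse-under K y B s t x s⊆t e with y ≡ᵇ x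
  ... | true = refl
  ... | false = ∧-intro (substitutable-collapse (extend K y) B s t x s⊆t (∧-conicalˡ _ _ e))
                        (no-capture (∨-elim (not (freeIn x B)) (∧-conicalʳ _ _ e)))
    where
    no-capture : not (freeIn x B) ≡ true ⊎ not (varInTerm y t) ≡ true →
                 not (freeIn x (collapse (extend K y) B)) ∨ not (varInTerm y s) ≡ true
    no-capture (inj₁ x∉B) =
      ∨-introˡ _ (cong not (notFree-collapse (extend K y) B x (not-true⇒false x∉B)))
    no-capture (inj₂ y∉t) with true-or-false (varInTerm y s)
    ... | inj₁ y∈s = ⊥-elim (true≢false (s⊆t y y∈s) (not-true⇒false y∉t))
    ... | inj₂ y∉s = ∨-introʳ _ (cong not y∉s)

  collapseTerm-subst : ∀ K t x u →
    collapseTerm K (substTerm t x u) ≡ substTerm (collapseTerm K t) x (collapseTerm (extend K x) u)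
  collapseTerm-subst K t x (var z) with x ≟ z
  ... | yes refl rewrite ≡ᵇ-refl x | ≡ᵇ-refl x = refl
  ... | no x≢z rewrite ≢⇒≡ᵇ-false x≢z | ≢⇒≡ᵇ-false (x≢z ∘ sym) with K z
  ...   | true rewrite ≢⇒≡ᵇ-false x≢z = refl
  ...   | false = refl
  collapseTerm-subst K t x (con c) with keptCon c
  ... | true = refl
  ... | false = refl

  collapse-subst : ∀ K B t x → substitutable t x B ≡ true →
                   collapse K (B [ t / x ]) ≡ collapse (extend K x) B [ collapseTerm K t / x ]
  collapse-subst-under :
    ∀ K y B t x → y ≢ x → substitutable t x B ∧ (not (freeIn x B) ∨ not (varInTerm y t)) ≡ true →
    collapse (extend K y) (B [ t / x ]) ≡ collapse (extend (extend K x) y) B [ collapseTerm K t / x ]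

  collapse-subst K ⊤' t x e = refl
  collapse-subst K ⊥' t x e = refl
  collapse-subst K (rel R ts) t x e =
    cong (rel R) (trans (sym (map-∘ ts)) (trans (map-cong (collapseTerm-subst K t x) ts) (map-∘ ts)))
  collapse-subst K (A ∧' B) t x e =
    cong₂ _∧'_ (collapse-subst K A t x (∧-conicalˡ _ _ e)) (collapse-subst K B t x (∧-conicalʳ _ _ e))
  collapse-subst K (A ∨' B) t x e =
    cong₂ _∨'_ (collapse-subst K A t x (∧-conicalˡ _ _ e)) (collapse-subst K B t x (∧-conicalʳ _ _ e))
  collapse-subst K (A ⇒ B) t x e =
    cong₂ _⇒_ (collapse-subst K A t x (∧-conicalˡ _ _ e)) (collapse-subst K B t x (∧-conicalʳ _ _ e))
  collapse-subst K (all y B) t x e with y ≟ x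
  ... | yes refl rewrite ≡ᵇ-refl y = cong (all y) (collapse-cong _ _ B λ z _ → sym (extend-idem K y z))
  ... | no y≢x rewrite ≢⇒≡ᵇ-false y≢x = cong (all y) (collapse-subst-under K y B t x y≢x e)
  collapse-subst K (ex y B) t x e with y ≟ x
  ... | yes refl rewrite ≡ᵇ-refl y = cong (ex y) (collapse-cong _ _ B λ z _ → sym (extend-idem K y z))
  ... | no y≢x rewrite ≢⇒≡ᵇ-false y≢x = cong (ex y) (collapse-subst-under K y B t x y≢x e)

  collapse-subst-under K y B t x y≢x e with ∨-elim (not (freeIn x B)) (∧-conicalʳ _ _ e)
  ... | inj₁ x∉B' = begin
      collapse (extend K y) (B [ t / x ])  ≡⟨ cong (collapse (extend K y)) (subst-notFree t x B x∉B) ⟩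
      collapse (extend K y) B              ≡⟨ collapse-cong _ _ B x-irrelevant ⟩
      collapse (extend (extend K x) y) B   ≡⟨ sym (subst-notFree _ x _ (notFree-collapse _ B x x∉B)) ⟩
      collapse (extend (extend K x) y) B [ collapseTerm K t / x ] ∎
    where
    open ≡-Reasoning
    x∉B : freeIn x B ≡ false
    x∉B = not-true⇒false x∉B'
    x-irrelevant : ∀ z → freeIn z B ≡ true → extend K y z ≡ extend (extend K x) y z
    x-irrelevant z z∈B rewrite ≢⇒≡ᵇ-false {z} {x} (λ { refl → true≢false z∈B x∉B }) = refl
  ... | inj₂ y∉t = begin
      collapse (extend K y) (B [ t / x ])
        ≡⟨ collapse-subst (extend K y) B t x (∧-conicalˡ _ _ e) ⟩
      collapse (extend (extend K y) x) B [ collapseTerm (extend K y) t / x ]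
        ≡⟨ cong₂ (λ F s → F [ s / x ]) (collapse-cong _ _ B (λ z _ → extend-comm K x y z))
                                       (collapseTerm-cong _ _ t y-irrelevant) ⟩
      collapse (extend (extend K x) y) B [ collapseTerm K t / x ] ∎
    where
    open ≡-Reasoning
    y-irrelevant : ∀ z → varInTerm z t ≡ true → extend K y z ≡ K z
    y-irrelevant z z∈t = extend-other K (λ { refl → true≢false z∈t (not-true⇒false y∉t) })

ConstantSearch : (ℕ → Bool) → Set
ConstantSearch P = (∃ λ c → P c ≡ true) ⊎ (∀ c → P c ≡ false)

search-∨ : ∀ {P Q : ℕ → Bool} → ConstantSearch P → ConstantSearch Q →
           ConstantSearch (λ c → P c ∨ Q c)
search-∨ (inj₁ (c , Pc)) _ = inj₁ (c , ∨-introˡ _ Pc)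
search-∨ {P} (inj₂ _) (inj₁ (c , Qc)) = inj₁ (c , ∨-introʳ (P c) Qc)
search-∨ (inj₂ noP) (inj₂ noQ) = inj₂ λ c → cong₂ _∨_ (noP c) (noQ c)

search-terms : ∀ ts → ConstantSearch (λ c → any (conInTerm c) ts)
search-terms [] = inj₂ λ _ → refl
search-terms (var _ ∷ ts) = search-terms ts
search-terms (con d ∷ ts) = inj₁ (d , ∨-introˡ _ (≡ᵇ-refl d))

search-formula : ∀ A → ConstantSearch (λ c → conIn c A)
search-formula ⊤' = inj₂ λ _ → refl
search-formula ⊥' = inj₂ λ _ → refl
search-formula (rel R ts) = search-terms ts
search-formula (A ∧' B) = search-∨ (search-formula A) (search-formula B)
search-formula (A ∨' B) = search-∨ (search-formula A) (search-formula B)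
search-formula (A ⇒ B) = search-∨ (search-formula A) (search-formula B)
search-formula (all y A) = search-formula A
search-formula (ex y A) = search-formula A

search-formulas : ∀ S → ConstantSearch (λ c → any (conIn c) S)
search-formulas [] = inj₂ λ _ → refl
search-formulas (A ∷ S) = search-∨ (search-formula A) (search-formulas S)

Pars*-constant : ∀ c₀ S → ∃ λ k → Pars* c₀ S (con k)
Pars*-constant c₀ S with search-formulas S
... | inj₁ (c , c∈S) = c , inj₁ (any-witness (conIn c) S c∈S)
... | inj₂ none = c₀ , inj₂ (refl , λ A c A∈S → any-false (conIn c) (none c) A∈S)

-- Evaluation in the glued model

module Localisation (c₀ : ℕ) (S H : List Formula) (H⊆S : H ⊆ S) where

  freeInS : VarSet
  freeInS z = any (freeIn z) S

  open Collapse (λ c → any (conIn c) S) (proj₁ (Pars*-constant c₀ S))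

  σ : Formula → Formula
  σ = collapse freeInS

  σᵗ : Term → Term
  σᵗ = collapseTerm freeInS

  σ-under : ℕ → Formula → Formula
  σ-under x = collapse (extend freeInS x)

  σ-fixes : ∀ {A} → A ∈ S → σ A ≡ A
  σ-fixes {A} A∈S =
    collapse-id freeInS A (λ z → any-intro (freeIn z) A∈S) (λ c → any-intro (conIn c) A∈S)

  σ-under-notFree : ∀ x B → freeIn x B ≡ false → σ B ≡ σ-under x B
  σ-under-notFree x B x∉B = collapse-cong _ _ B λ z z∈B →
    sym (extend-other freeInS λ { refl → true≢false z∈B x∉B })

  σ-subst : ∀ x B t → substitutable t x B ≡ true → σ (B [ t / x ]) ≡ σ-under x B [ σᵗ t / x ]
  σ-subst x B t = collapse-subst freeInS B t x

  σ-substitutable : ∀ x B t → substitutable t x B ≡ true →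
                    substitutable (σᵗ t) x (σ-under x B) ≡ true
  σ-substitutable x B t =
    substitutable-collapse _ B (σᵗ t) t x (λ y → proj₁ ∘ varInTerm-collapse freeInS t y)

  σ-SubF : ∀ {B A} → SubF B A → A ∈ S → SubF (σ B) A
  σ-SubF {A = A} self A∈S = subst (λ F → SubF F A) (sym (σ-fixes A∈S)) self
  σ-SubF (∧l p) A∈S = ∧l (σ-SubF p A∈S)
  σ-SubF (∧r p) A∈S = ∧r (σ-SubF p A∈S)
  σ-SubF (∨l p) A∈S = ∨l (σ-SubF p A∈S)
  σ-SubF (∨r p) A∈S = ∨r (σ-SubF p A∈S)
  σ-SubF (⇒l p) A∈S = ⇒l (σ-SubF p A∈S)
  σ-SubF (⇒r p) A∈S = ⇒r (σ-SubF p A∈S)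
  σ-SubF {A = A} (∀s {x = x} {B = B} t q p) A∈S =
    subst (λ F → SubF F A) (sym (σ-subst x B t q))
          (∀s (σᵗ t) (σ-substitutable x B t q) (σ-SubF p A∈S))
  σ-SubF {A = A} (∃s {x = x} {B = B} t q p) A∈S =
    subst (λ F → SubF F A) (sym (σ-subst x B t q))
          (∃s (σᵗ t) (σ-substitutable x B t q) (σ-SubF p A∈S))

  σ-Pars* : ∀ B → IsPFormula (Pars* c₀ S) (σ B)
  σ-Pars* B (var z) z∈σB =
    inj₁ (any-witness (freeIn z) S (proj₂ (freeIn-collapse freeInS B z z∈σB)))
  σ-Pars* B (con c) c∈σB with conIn-collapse freeInS B c c∈σB
  ... | inj₁ c∈S = inj₁ (any-witness (conIn c) S c∈S)
  ... | inj₂ refl = proj₂ (Pars*-constant c₀ S)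

  Sub : Formula → Set
  Sub B = ∃ λ A → A ∈ S × SubF B A

  Sub-map : ∀ {B C} → (∀ {A} → SubF B A → SubF C A) → Sub B → Sub C
  Sub-map f (A , A∈S , p) = A , A∈S , f p

  σ-closure : ∀ {B} → Sub B → InClosure c₀ S (σ B)
  σ-closure {B} (A , A∈S , p) = (A , A∈S , σ-SubF p A∈S) , σ-Pars* B

  Local : List Formula → List Formula → Set
  Local hs as = hs ⊆ H × All (InClosure c₀ S) as

  Local-++ : ∀ {hs as hs′ as′} → Local hs as → Local hs′ as′ →
             Local (hs ++ hs′) (as ++ as′)
  Local-++ {hs} (h , a) (h′ , a′) = [ h , h′ ]′ ∘ ∈-++⁻ hs , ++⁺ a a′

  LocalDeriv : Formula → Set
  LocalDeriv F = Σ (Deriv F) λ d → Local (hyps d) (axioms d)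

  mutual
    data ⟦_⟧ (B : Formula) : Set where
      local  : Sub B → LocalDeriv (σ B) → ⟦ B ⟧
      absurd : LocalDeriv ⊥' → ⟦ B ⟧
      struct : Structural B → ⟦ B ⟧

    Structural : Formula → Set
    Structural ⊤' = ⊤
    Structural ⊥' = ⊥
    Structural (rel _ _) = ⊥
    Structural (B ∧' C) = ⟦ B ⟧ × ⟦ C ⟧
    Structural (B ∨' C) = ⟦ B ⟧ ⊎ ⟦ C ⟧
    Structural (B ⇒ C) = ⟦ C ⟧ ⊎ B ≡ C  -- the second summand is the axiom B ⇒ B
    Structural (all x B) = freeIn x B ≡ false × ⟦ B ⟧
    Structural (ex x B) = ∃ λ t → substitutable t x B ≡ true × ⟦ B [ t / x ] ⟧

  mutual
    reify : ∀ {B} → Sub B → ⟦ B ⟧ → LocalDeriv (σ B)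
    reify s (local _ d) = d
    reify s (absurd (d , ev)) = ⊥E _ d , ev
    reify s (struct v) = reifyStructural s v

    reifyStructural : ∀ {B} → Sub B → Structural B → LocalDeriv (σ B)
    reifyStructural {⊤'} s tt = ax⊤ , (λ ()) , σ-closure s ∷ []
    reifyStructural {B ∧' C} s (v , w) with reify (Sub-map ∧l s) v | reify (Sub-map ∧r s) w
    ... | d , ev | e , ev′ = ∧I d e , Local-++ ev ev′
    reifyStructural {B ∨' C} s (inj₁ v) with reify (Sub-map ∨l s) v
    ... | d , ev = ∨I₁ (σ C) d , ev
    reifyStructural {B ∨' C} s (inj₂ w) with reify (Sub-map ∨r s) w
    ... | d , ev = ∨I₂ (σ B) d , ev
    reifyStructural {B ⇒ C} s (inj₁ w) with reify (Sub-map ⇒r s) w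
    ... | d , ev = ⇒I (σ B) d , ev
    reifyStructural {B ⇒ .B} s (inj₂ refl) = axId (σ B) , (λ ()) , σ-closure s ∷ []
    reifyStructural {all x B} s (x∉B , v)
      with subst LocalDeriv (σ-under-notFree x B x∉B) (reify (Sub-map SubF-all-body s) v)
    ... | d , ev = ∀I x (notFree-collapse _ B x x∉B) d , ev
    reifyStructural {ex x B} s (t , q , v)
      with subst LocalDeriv (σ-subst x B t q) (reify (Sub-map (∃s t q) s) v)
    ... | d , ev = ∃I x (σ-under x B) (σᵗ t) (σ-substitutable x B t q) d , ev

  hypothesis : ∀ {A} → A ∈ H → ⟦ A ⟧
  hypothesis {A} A∈H =
    local (A , H⊆S A∈H , self)
          (subst LocalDeriv (sym (σ-fixes (H⊆S A∈H))) (hyp A , (λ { (here refl) → A∈H }) , []))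

  fst : ∀ {B C} → ⟦ B ∧' C ⟧ → ⟦ B ⟧
  fst (local s (d , ev)) = local (Sub-map ∧l s) (∧E₁ d , ev)
  fst (absurd p) = absurd p
  fst (struct (v , _)) = v

  snd : ∀ {B C} → ⟦ B ∧' C ⟧ → ⟦ C ⟧
  snd (local s (d , ev)) = local (Sub-map ∧r s) (∧E₂ d , ev)
  snd (absurd p) = absurd p
  snd (struct (_ , w)) = w

  contract : ∀ {B} → ⟦ B ∨' B ⟧ → ⟦ B ⟧
  contract (local s (d , ev)) = local (Sub-map ∨l s) (∨E d , ev)
  contract (absurd p) = absurd p
  contract (struct (inj₁ v)) = v
  contract (struct (inj₂ v)) = v

  apply : ∀ {B C} → ⟦ B ⟧ → ⟦ B ⇒ C ⟧ → ⟦ C ⟧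
  apply v (local s (f , evf)) with reify (Sub-map ⇒l s) v
  ... | d , ev = local (Sub-map ⇒r s) (⇒E d f , Local-++ ev evf)
  apply v (absurd p) = absurd p
  apply v (struct (inj₁ w)) = w
  apply v (struct (inj₂ refl)) = v

  exFalso : ∀ {B} → ⟦ ⊥' ⟧ → ⟦ B ⟧
  exFalso (local _ p) = absurd p
  exFalso (absurd p) = absurd p

  instantiate : ∀ {x B} t → substitutable t x B ≡ true → ⟦ all x B ⟧ → ⟦ B [ t / x ] ⟧
  instantiate {x} {B} t q (local s (d , ev)) =
    local (Sub-map (∀s t q) s)
          (subst LocalDeriv (sym (σ-subst x B t q)) (∀E (σᵗ t) (σ-substitutable x B t q) d , ev))
  instantiate t q (absurd p) = absurd p
  instantiate {x} {B} t q (struct (x∉B , v)) = subst ⟦_⟧ (sym (subst-notFree t x B x∉B)) v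

  unpack : ∀ {x B} → freeIn x B ≡ false → ⟦ ex x B ⟧ → ⟦ B ⟧
  unpack {x} {B} x∉B (local s (d , ev)) =
    local (Sub-map SubF-ex-body s)
          (subst LocalDeriv (sym (σ-under-notFree x B x∉B)) (∃E (notFree-collapse _ B x x∉B) d , ev))
  unpack x∉B (absurd p) = absurd p
  unpack {x} {B} x∉B (struct (t , _ , v)) = subst ⟦_⟧ (subst-notFree t x B x∉B) v

  eval : ∀ {B} (d : Deriv B) → hyps d ⊆ H → ⟦ B ⟧
  eval ax⊤ _ = struct tt
  eval (axId A) _ = struct (inj₂ refl)
  eval (hyp A) h = hypothesis (h (here refl))
  eval (∧I d e) h = struct (eval d (h ∘ ∈-++⁺ˡ) , eval e (h ∘ ∈-++⁺ʳ (hyps d)))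
  eval (∧E₁ d) h = fst (eval d h)
  eval (∧E₂ d) h = snd (eval d h)
  eval (∨I₁ B d) h = struct (inj₁ (eval d h))
  eval (∨I₂ A d) h = struct (inj₂ (eval d h))
  eval (∨E d) h = contract (eval d h)
  eval (⇒I A d) h = struct (inj₁ (eval d h))
  eval (⇒E d e) h = apply (eval d (h ∘ ∈-++⁺ˡ)) (eval e (h ∘ ∈-++⁺ʳ (hyps d)))
  eval (⊥E A d) h = exFalso (eval d h)
  eval (∀I x x∉A d) h = struct (x∉A , eval d h)
  eval (∀E t q d) h = instantiate t q (eval d h)
  eval (∃I x A t q d) h = struct (t , q , eval d h)
  eval (∃E x∉A d) h = unpack x∉A (eval d h)

  localise : ∀ {A} → A ∈ S → (d : Deriv A) → hyps d ⊆ H → LocalDeriv A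
  localise A∈S d h = subst LocalDeriv (σ-fixes A∈S) (reify (_ , A∈S , self) (eval d h))

-- Restoring hypotheses

addHyps : ∀ {A} → Deriv A → List Formula → Deriv A
addHyps d [] = d
addHyps d (h ∷ hs) = ∧E₁ (∧I (addHyps d hs) (hyp h))

∈-hyps-addHyps⁻ : ∀ {A} (d : Deriv A) hs {B} → B ∈ hyps (addHyps d hs) →
                  B ∈ hyps d ⊎ B ∈ hs
∈-hyps-addHyps⁻ d [] B∈ = inj₁ B∈
∈-hyps-addHyps⁻ d (h ∷ hs) B∈ with ∈-++⁻ (hyps (addHyps d hs)) B∈
... | inj₂ (here refl) = inj₂ (here refl)
... | inj₁ B∈′ = map₂ there (∈-hyps-addHyps⁻ d hs B∈′)

∈-hyps-addHyps⁺ : ∀ {A} (d : Deriv A) hs {B} → B ∈ hs → B ∈ hyps (addHyps d hs)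
∈-hyps-addHyps⁺ d (h ∷ hs) (here refl) = ∈-++⁺ʳ (hyps (addHyps d hs)) (here refl)
∈-hyps-addHyps⁺ d (h ∷ hs) (there B∈) = ∈-++⁺ˡ (∈-hyps-addHyps⁺ d hs B∈)

hyps-addHyps : ∀ {A} (d : Deriv A) hs → hyps d ⊆ hs → ∀ B → B ∈ hyps (addHyps d hs) ⇔ B ∈ hs
hyps-addHyps d hs d⊆hs B = mk⇔ ([ d⊆hs , id ]′ ∘ ∈-hyps-addHyps⁻ d hs) (∈-hyps-addHyps⁺ d hs)

axioms-addHyps : ∀ {A} (d : Deriv A) hs → axioms (addHyps d hs) ≡ axioms d
axioms-addHyps d [] = refl
axioms-addHyps d (h ∷ hs) = trans (++-identityʳ _) (axioms-addHyps d hs)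

lemma6p14 : (c₀ : ℕ) (A : Formula) (d : Deriv A) →
    Σ (Deriv A) λ d′ →
    (∀ B → B ∈ hyps d′ ⇔ B ∈ hyps d)
    × All (InClosure c₀ (A ∷ hyps d)) (axioms d′)
lemma6p14 c₀ A d with Localisation.localise c₀ (A ∷ hyps d) (hyps d) there (here refl) d id
... | d₁ , hyps⊆ , axioms-local =
  addHyps d₁ (hyps d) ,
  hyps-addHyps d₁ (hyps d) hyps⊆ ,
  subst (All _) (sym (axioms-addHyps d₁ (hyps d))) axioms-local
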